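{- Let $\mathrm{M}$ be a matroid. The monomials $$\{h_{F_1}^{a_1} \dotsb h_{F_\ell}^{a_\ell} : \emptyset = F_0 < F_1 < \dotsb < F_\ell,\ a_i < \operatorname{rk}(F_i) - \operatorname{rk}(F_{i-1}) \text{ for } i=1, \dotsc, \ell\}$$ (with $\ell \ge 0$ and all $a_i \ge 1$) span $\underline{A}^{\bullet}(\mathrm{M})$ over $\mathbb{Z}$.
   Context: A matroid $\mathrm{M}$ is a finite nonempty atomic ranked lattice $\mathcal{L}_{\mathrm{M}}$ (every element is the join of the atoms below it; every maximal chain in $[\emptyset, F]$ has length $\operatorname{rk}(F)$) whose rank function $\operatorname{rk}$ is submodular. Elements are called flats; minimal element $\emptyset$, maximal $E$. Let $\overline{\mathcal{L}}_{\mathrm{M}} = \mathcal{L}_{\mathrm{M}} \setminus \{\emptyset\}$. The Chow ring is $$\underline{A}^{\bullet}(\mathrm{M}) = \frac{\mathbb{Z}[h_F]_{F \in \overline{\mathcal{L}}_{\mathrm{M}}}}{((h_{F} - h_{G \vee F})(h_G - h_{G \vee F}) : F, G \in \overline{\mathcal{L}}_{\mathrm{M}}) + (h_a : a \text{ an atom})}.$$ -}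

module Defs where

open import Level using (0ℓ)
open import Data.Nat using (ℕ; zero; suc; _≤_; _<_; _∸_)
import Data.Nat as ℕ
open import Data.Fin using (Fin)
import Data.Fin as Fin
open import Data.Integer using (ℤ; +_; -_)
import Data.Integer as ℤ
open import Data.Vec using (Vec; replicate; zipWith; updateAt; lookup)
open import Data.Vec.Properties using (≡-dec)
open import Data.List using (List; []; _∷_; _++_; map; concatMap; foldr)
open import Data.List.Relation.Unary.All using (All)
open import Data.Product using (Σ; _×_; _,_; ∃; ∃-syntax)
open import Data.Sum using (_⊎_)
open import Relation.Binary.PropositionalEquality using (_≡_; _≢_)
open import Relation.Nullary using (¬_; yes; no)

record FinLattice (n : ℕ) : Set₁ where
  field
    _≼_      : Fin n → Fin n → Set
    ≼-refl   : ∀ x → x ≼ x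
    ≼-trans  : ∀ {x y z} → x ≼ y → y ≼ z → x ≼ z
    ≼-antisym : ∀ {x y} → x ≼ y → y ≼ x → x ≡ y
    _∨_      : Fin n → Fin n → Fin n
    ∨-ubˡ    : ∀ x y → x ≼ (x ∨ y)
    ∨-ubʳ    : ∀ x y → y ≼ (x ∨ y)
    ∨-least  : ∀ {x y z} → x ≼ z → y ≼ z → (x ∨ y) ≼ z
    _∧_      : Fin n → Fin n → Fin n
    ∧-lbˡ    : ∀ x y → (x ∧ y) ≼ x
    ∧-lbʳ    : ∀ x y → (x ∧ y) ≼ y
    ∧-greatest : ∀ {x y z} → z ≼ x → z ≼ y → z ≼ (x ∧ y)
    ⊥        : Fin n
    ⊥-min    : ∀ x → ⊥ ≼ x
    ⊤        : Fin n
    ⊤-max    : ∀ x → x ≼ ⊤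

module LatticeNotions {n : ℕ} (L : FinLattice n) where
  open FinLattice L

  _≺_ : Fin n → Fin n → Set
  x ≺ y = x ≼ y × x ≢ y

  _⋖_ : Fin n → Fin n → Set
  x ⋖ y = x ≺ y × (∀ z → x ≺ z → z ≺ y → Data.Empty.⊥)
    where import Data.Empty

  IsAtom : Fin n → Set
  IsAtom a = ⊥ ⋖ a

  data SatChain : Fin n → Fin n → ℕ → Set where
    done : ∀ x → SatChain x x zero
    step : ∀ {x y z k} → x ⋖ y → SatChain y z k → SatChain x z (suc k)

record Matroid (n : ℕ) : Set₁ where
  field
    lattice : FinLattice n
  open FinLattice lattice public
  open LatticeNotions lattice public
  field
    rk : Fin n → ℕ
    -- atomic: every flat is the join (least upper bound) of the atoms below it
    atomic : ∀ F G → (∀ a → IsAtom a → a ≼ F → a ≼ G) → F ≼ G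
    ranked : ∀ F k → SatChain ⊥ F k → k ≡ rk F
    submodular : ∀ F G → rk (F ∨ G) ℕ.+ rk (F ∧ G) ≤ rk F ℕ.+ rk G

-- Polynomials over ℤ in variables h_F (F : Fin n), represented as
-- finite formal sums  Σ c · h^e  (lists of (coefficient, exponent vector)).

Mon : ℕ → Set
Mon n = Vec ℕ n

Poly : ℕ → Set
Poly n = List (ℤ × Mon n)

coeff : ∀ {n} → Poly n → Mon n → ℤ
coeff [] m = + 0
coeff ((c , e) ∷ p) m with ≡-dec Data.Nat._≟_ e m
  where import Data.Nat
... | yes _ = c ℤ.+ coeff p m
... | no  _ = coeff p m

_≈P_ : ∀ {n} → Poly n → Poly n → Set
p ≈P q = ∀ m → coeff p m ≡ coeff q m

_+P_ : ∀ {n} → Poly n → Poly n → Poly n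
p +P q = p ++ q

_*P_ : ∀ {n} → Poly n → Poly n → Poly n
p *P q = concatMap (λ { (c , e) → map (λ { (d , f) → (c ℤ.* d , zipWith ℕ._+_ e f) }) q }) p

unitExp : ∀ {n} → Fin n → Mon n
unitExp F = updateAt (replicate _ 0) F (λ _ → 1)

var : ∀ {n} → Fin n → Poly n
var F = (+ 1 , unitExp F) ∷ []

varDiff : ∀ {n} → Fin n → Fin n → Poly n
varDiff F G = (+ 1 , unitExp F) ∷ (- (+ 1) , unitExp G) ∷ []

module ChowRing {n : ℕ} (M : Matroid n) where
  open Matroid M

  -- polynomials in the variables h_F with F ∈ L \ {∅}: no h_∅ occurs
  ValidPoly : Poly n → Set
  ValidPoly p = All (λ t → lookup (Data.Product.proj₂ t) ⊥ ≡ 0) p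
    where import Data.Product

  IsGenerator : Poly n → Set
  IsGenerator g =
      (Σ (Fin n) λ F → Σ (Fin n) λ G → F ≢ ⊥ × G ≢ ⊥ ×
         (g ≡ (varDiff F (G ∨ F) *P varDiff G (G ∨ F))))
    ⊎ (Σ (Fin n) λ a → IsAtom a × g ≡ var a)

  IdealWitness : Set
  IdealWitness = List (Poly n × Poly n)

  ValidIdealWitness : IdealWitness → Set
  ValidIdealWitness = All (λ { (q , g) → ValidPoly q × IsGenerator g })

  idealElem : IdealWitness → Poly n
  idealElem = foldr (λ { (q , g) acc → (q *P g) +P acc }) []

  -- chains ∅ = F₀ < F₁ < … < F_ℓ with exponents a_i, given as the list
  -- ((F₁ , a₁) ∷ … ∷ (F_ℓ , a_ℓ) ∷ []), starting from F₀ = ∅.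
  ValidChainFrom : Fin n → List (Fin n × ℕ) → Set
  ValidChainFrom prev [] = Data.Unit.⊤
    where import Data.Unit
  ValidChainFrom prev ((F , a) ∷ rest) =
    prev ≺ F × 1 ≤ a × a < rk F ∸ rk prev × ValidChainFrom F rest

  ValidChain : List (Fin n × ℕ) → Set
  ValidChain = ValidChainFrom ⊥

  chainExp : List (Fin n × ℕ) → Mon n
  chainExp [] = replicate _ 0
  chainExp ((F , a) ∷ rest) = updateAt (chainExp rest) F (ℕ._+ a)

  combination : List (ℤ × List (Fin n × ℕ)) → Poly n
  combination = map (λ { (c , ch) → (c , chainExp ch) })

-- Every monomial is rewritten, modulo the ideal, by three kinds of moves.
--  * If two incomparable flats F and G occur, use h_F h_G = h_F h_J + h_J h_G − h_J², where J = F ∨ G.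
--  * If the flats occurring form a chain and the exponent a of a flat H reaches rk H − rk P,
--    where P ≠ ∅ is the preceding flat, use h_P h_H^a = h_H^(a+1).
--  * If the exponent a of the least flat H reaches rk H, then h_H^a = 0.
-- For a cover X ⋖ Y with X ≠ ∅ we have Y = X ∨ a for an atom a, and the generator
-- (h_a − h_Y)(h_X − h_Y) together with h_a = 0 gives h_X h_Y = h_Y². The last two moves follow
-- from this by induction along a saturated chain from P (or from ∅) to H, which has length
-- rk H − rk P. Every move strictly decreases Σ_F e_F (rk E − rk F), so the rewriting terminates, and
-- a monomial admitting no move is one of the distinguished monomials.
module Submission where

open import Defs
open import Level using (0ℓ)
open import Algebra.Bundles using (CommutativeMonoid)
import Algebra.Properties.CommutativeSemigroup as CommutativeSemigroupProperties
open import Data.Nat using (ℕ; zero; suc; _+_; _*_; _∸_; _≤_; _<_; _<?_; s≤s; z≤n; pred; >-nonZero)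
import Data.Nat.Properties as ℕ
open import Data.Nat.Induction using (<-wellFounded)
open import Data.Fin using (Fin)
import Data.Fin as Fin
import Data.Fin.Properties as Fin
open import Data.Fin.Induction using (po-wellFounded; po-noetherian)
open import Data.Integer using (ℤ; +_; -_)
import Data.Integer as ℤ
import Data.Integer.Properties as ℤ
open import Data.Integer.Tactic.RingSolver using (solve-∀)
open import Data.Vec using ([]; _∷_; replicate; zipWith; updateAt; lookup)
import Data.Vec.Properties as Vec
open import Data.Vec.Properties using (≡-dec)
open import Data.Vec.Relation.Binary.Pointwise.Extensional using (ext; Pointwise-≡⇒≡)
open import Data.List using (List; []; _∷_; _++_)
import Data.List.Properties as List
open import Data.List.Relation.Unary.All using (All; []; _∷_)
import Data.List.Relation.Unary.All.Properties as All
open import Data.Product using (Σ; ∃; ∃₂; _×_; _,_; proj₁; proj₂)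
open import Data.Sum using (_⊎_; inj₁; inj₂)
import Data.Sum as Sum
import Data.Unit as Unit
open import Function using (_∘_; const; flip)
open import Induction.WellFounded using (WellFounded; Acc; acc; module Subrelation)
open import Relation.Binary using (IsPartialOrder; IsEquivalence; Setoid; Decidable)
import Relation.Binary.Construct.On as On
open import Relation.Binary.PropositionalEquality
  using (_≡_; _≢_; refl; sym; trans; cong; cong₂; subst; subst₂; isEquivalence; module ≡-Reasoning)
open import Relation.Binary.PropositionalEquality.Algebra using (isMagma)
import Relation.Binary.Reasoning.Setoid as SetoidReasoning
open import Relation.Nullary using (¬_; yes; no; contradiction)
open import Relation.Nullary.Decidable using (_×-dec_; ¬?; map′)
open import Relation.Unary using (Pred)
import Relation.Unary as U

private variable n : ℕ

infixl 6 _⊕_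

_⊕_ : Mon n → Mon n → Mon n
_⊕_ = zipWith _+_

𝟎 : Mon n
𝟎 = replicate _ 0

⊕-commutativeMonoid : ℕ → CommutativeMonoid 0ℓ 0ℓ
⊕-commutativeMonoid n = record
  { Carrier = Mon n
  ; _≈_ = _≡_
  ; _∙_ = _⊕_
  ; ε = 𝟎
  ; isCommutativeMonoid = record
    { isMonoid = record
      { isSemigroup = record { isMagma = isMagma _⊕_ ; assoc = Vec.zipWith-assoc ℕ.+-assoc }
      ; identity = Vec.zipWith-identityˡ ℕ.+-identityˡ , Vec.zipWith-identityʳ ℕ.+-identityʳ
      }
    ; comm = Vec.zipWith-comm ℕ.+-comm
    }
  }

module _ {n : ℕ} where
  open CommutativeMonoid (⊕-commutativeMonoid n) public
    using () renaming (assoc to ⊕-assoc; comm to ⊕-comm; identityˡ to ⊕-identityˡ)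
  open CommutativeSemigroupProperties (CommutativeMonoid.commutativeSemigroup (⊕-commutativeMonoid n)) public
    using (interchange; x∙yz≈y∙xz; x∙yz≈xz∙y; x∙yz≈yx∙z)

open CommutativeSemigroupProperties ℕ.+-commutativeSemigroup using () renaming (interchange to +-interchange)
open CommutativeSemigroupProperties ℤ.+-commutativeSemigroup using () renaming (interchange to ℤ+-interchange)

xy⊕zw≡yw⊕xz : ∀ (x y z w : Mon n) → (x ⊕ y) ⊕ (z ⊕ w) ≡ (y ⊕ w) ⊕ (x ⊕ z)
xy⊕zw≡yw⊕xz x y z w = trans (interchange x y z w) (⊕-comm (x ⊕ z) (y ⊕ w))

𝟎-by-lookup : ∀ (e : Mon n) → (∀ i → lookup e i ≡ 0) → 𝟎 ≡ e
𝟎-by-lookup e e≡0 = Pointwise-≡⇒≡ (ext λ i → trans (Vec.lookup-replicate i 0) (sym (e≡0 i)))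

powExp : Fin n → ℕ → Mon n
powExp F zero    = 𝟎
powExp F (suc a) = unitExp F ⊕ powExp F a

unitExp-⊕ : ∀ (F : Fin n) e → unitExp F ⊕ e ≡ updateAt e F suc
unitExp-⊕ Fin.zero    (x ∷ e) = cong (suc x ∷_) (Vec.zipWith-identityˡ ℕ.+-identityˡ e)
unitExp-⊕ (Fin.suc F) (x ∷ e) = cong (x ∷_) (unitExp-⊕ F e)

powExp-⊕ : ∀ (F : Fin n) a e → powExp F a ⊕ e ≡ updateAt e F (_+ a)
powExp-⊕ F zero e = begin
  𝟎 ⊕ e                 ≡⟨ ⊕-identityˡ e ⟩
  e                     ≡⟨ Vec.updateAt-id-local F e (ℕ.+-identityʳ _) ⟨
  updateAt e F (_+ 0)   ∎
  where open ≡-Reasoning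
powExp-⊕ F (suc a) e = begin
  (unitExp F ⊕ powExp F a) ⊕ e             ≡⟨ ⊕-assoc (unitExp F) _ e ⟩
  unitExp F ⊕ (powExp F a ⊕ e)             ≡⟨ cong (unitExp F ⊕_) (powExp-⊕ F a e) ⟩
  unitExp F ⊕ updateAt e F (_+ a)          ≡⟨ unitExp-⊕ F _ ⟩
  updateAt (updateAt e F (_+ a)) F suc     ≡⟨ Vec.updateAt-updateAt-local F e (sym (ℕ.+-suc _ a)) ⟩
  updateAt e F (_+ suc a)                  ∎
  where open ≡-Reasoning

decr : Fin n → Mon n → Mon n
decr F e = updateAt e F pred

unitExp-⊕-decr : ∀ (F : Fin n) e → 0 < lookup e F → unitExp F ⊕ decr F e ≡ e
unitExp-⊕-decr F e 0<eF = begin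
  unitExp F ⊕ decr F e          ≡⟨ unitExp-⊕ F (decr F e) ⟩
  updateAt (decr F e) F suc     ≡⟨ Vec.updateAt-updateAt-local F e (ℕ.suc-pred _ {{>-nonZero 0<eF}}) ⟩
  updateAt e F (λ x → x)        ≡⟨ Vec.updateAt-id F e ⟩
  e                             ∎
  where open ≡-Reasoning

decr-decr-⊕-unitExps : ∀ {F G : Fin n} e → F ≢ G → 0 < lookup e F → 0 < lookup e G →
                       decr G (decr F e) ⊕ (unitExp F ⊕ unitExp G) ≡ e
decr-decr-⊕-unitExps {F = F} {G} e F≢G 0<eF 0<eG = begin
  decr G (decr F e) ⊕ (unitExp F ⊕ unitExp G)    ≡⟨ ⊕-comm _ _ ⟩
  (unitExp F ⊕ unitExp G) ⊕ decr G (decr F e)    ≡⟨ ⊕-assoc (unitExp F) _ _ ⟩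
  unitExp F ⊕ (unitExp G ⊕ decr G (decr F e))    ≡⟨ cong (unitExp F ⊕_) (unitExp-⊕-decr G (decr F e) 0<[decrFe]G) ⟩
  unitExp F ⊕ decr F e                           ≡⟨ unitExp-⊕-decr F e 0<eF ⟩
  e                                              ∎
  where
  open ≡-Reasoning
  0<[decrFe]G : 0 < lookup (decr F e) G
  0<[decrFe]G = subst (0 <_) (sym (Vec.lookup∘updateAt′ G F (F≢G ∘ sym) e)) 0<eG

weight : (Fin n → ℕ) → Mon n → ℕ
weight w []      = 0
weight w (x ∷ e) = x * w Fin.zero + weight (w ∘ Fin.suc) e

weight-⊕ : ∀ (w : Fin n → ℕ) u v → weight w (u ⊕ v) ≡ weight w u + weight w v
weight-⊕ w []      []      = refl
weight-⊕ w (x ∷ u) (y ∷ v) = begin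
  (x + y) * w Fin.zero + weight w′ (u ⊕ v)
    ≡⟨ cong₂ _+_ (ℕ.*-distribʳ-+ (w Fin.zero) x y) (weight-⊕ w′ u v) ⟩
  (x * w Fin.zero + y * w Fin.zero) + (weight w′ u + weight w′ v)
    ≡⟨ +-interchange (x * w Fin.zero) (y * w Fin.zero) _ _ ⟩
  (x * w Fin.zero + weight w′ u) + (y * w Fin.zero + weight w′ v)
    ∎
  where
  open ≡-Reasoning
  w′ = w ∘ Fin.suc

weight-𝟎 : ∀ (w : Fin n → ℕ) → weight w 𝟎 ≡ 0
weight-𝟎 {zero}  w = refl
weight-𝟎 {suc n} w = weight-𝟎 (w ∘ Fin.suc)

weight-unitExp : ∀ (w : Fin n → ℕ) F → weight w (unitExp F) ≡ w F
weight-unitExp w Fin.zero    =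
  trans (cong₂ _+_ (ℕ.*-identityˡ (w Fin.zero)) (weight-𝟎 (w ∘ Fin.suc))) (ℕ.+-identityʳ (w Fin.zero))
weight-unitExp w (Fin.suc F) = weight-unitExp (w ∘ Fin.suc) F

δ : Mon n → Mon n → ℤ
δ e m with ≡-dec ℕ._≟_ e m
... | yes _ = + 1
... | no  _ = + 0

δ-sum : Poly n → Mon n → ℤ
δ-sum []            m = + 0
δ-sum ((c , e) ∷ p) m = c ℤ.* δ e m ℤ.+ δ-sum p m

coeff≡δ-sum : ∀ (p : Poly n) m → coeff p m ≡ δ-sum p m
coeff≡δ-sum []            m = refl
coeff≡δ-sum ((c , e) ∷ p) m with ≡-dec ℕ._≟_ e m
... | yes _ = cong₂ ℤ._+_ (sym (ℤ.*-identityʳ c)) (coeff≡δ-sum p m)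
... | no  _ = trans (coeff≡δ-sum p m) (sym (trans (cong (ℤ._+ δ-sum p m) (ℤ.*-zeroʳ c)) (ℤ.+-identityˡ _)))

δ-sum-++ : ∀ (p q : Poly n) m → δ-sum (p ++ q) m ≡ δ-sum p m ℤ.+ δ-sum q m
δ-sum-++ []            q m = sym (ℤ.+-identityˡ _)
δ-sum-++ ((c , e) ∷ p) q m =
  trans (cong (λ s → c ℤ.* δ e m ℤ.+ s) (δ-sum-++ p q m)) (sym (ℤ.+-assoc (c ℤ.* δ e m) _ _))

coeff-++ : ∀ (p q : Poly n) m → coeff (p ++ q) m ≡ coeff p m ℤ.+ coeff q m
coeff-++ p q m = begin
  coeff (p ++ q) m                 ≡⟨ coeff≡δ-sum (p ++ q) m ⟩
  δ-sum (p ++ q) m                 ≡⟨ δ-sum-++ p q m ⟩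
  δ-sum p m ℤ.+ δ-sum q m          ≡⟨ cong₂ ℤ._+_ (coeff≡δ-sum p m) (coeff≡δ-sum q m) ⟨
  coeff p m ℤ.+ coeff q m          ∎
  where open ≡-Reasoning

≈P-by-δ-sum : ∀ {p q : Poly n} → (∀ m → δ-sum p m ≡ δ-sum q m) → p ≈P q
≈P-by-δ-sum {p = p} {q} eq m = trans (coeff≡δ-sum p m) (trans (eq m) (sym (coeff≡δ-sum q m)))

δ-sum-resp : ∀ {p q : Poly n} → p ≈P q → ∀ m → δ-sum p m ≡ δ-sum q m
δ-sum-resp {p = p} {q} p≈q m = trans (sym (coeff≡δ-sum p m)) (trans (p≈q m) (coeff≡δ-sum q m))

negate-swap : ∀ c x y i → - c ℤ.* x ℤ.+ + 0 ≡ - c ℤ.* y ℤ.+ i → c ℤ.* y ℤ.+ + 0 ≡ c ℤ.* x ℤ.+ i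
negate-swap c x y i h = begin
  c ℤ.* y ℤ.+ + 0                                     ≡⟨ isolate c x y ⟩
  c ℤ.* x ℤ.+ ((- c ℤ.* x ℤ.+ + 0) ℤ.- (- c ℤ.* y))   ≡⟨ cong (λ t → c ℤ.* x ℤ.+ (t ℤ.- (- c ℤ.* y))) h ⟩
  c ℤ.* x ℤ.+ ((- c ℤ.* y ℤ.+ i) ℤ.- (- c ℤ.* y))     ≡⟨ cancel c x y i ⟩
  c ℤ.* x ℤ.+ i                                       ∎
  where
  open ≡-Reasoning
  isolate : ∀ c x y → c ℤ.* y ℤ.+ + 0 ≡ c ℤ.* x ℤ.+ ((- c ℤ.* x ℤ.+ + 0) ℤ.- (- c ℤ.* y))
  isolate = solve-∀
  cancel : ∀ c x y i → c ℤ.* x ℤ.+ ((- c ℤ.* y ℤ.+ i) ℤ.- (- c ℤ.* y)) ≡ c ℤ.* x ℤ.+ i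
  cancel = solve-∀

-- Coefficientwise form of h_Y h_X = h_Y² + h_a h_X − h_a h_Y − (h_a − h_Y)(h_X − h_Y).
cover-identity : ∀ c x y p q →
  c ℤ.* x ℤ.+ + 0 ≡
  c ℤ.* y ℤ.+ (c ℤ.* p ℤ.+ (- c ℤ.* q ℤ.+
    ((- c ℤ.* (+ 1 ℤ.* + 1)) ℤ.* p ℤ.+ ((- c ℤ.* (+ 1 ℤ.* - + 1)) ℤ.* q ℤ.+
    ((- c ℤ.* (- + 1 ℤ.* + 1)) ℤ.* x ℤ.+ ((- c ℤ.* (- + 1 ℤ.* - + 1)) ℤ.* y ℤ.+ + 0))))))
cover-identity = solve-∀

-- Coefficientwise form of h_F h_G = h_F h_J + h_J h_G − h_J² + (h_F − h_J)(h_G − h_J).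
join-identity : ∀ c x y z w →
  c ℤ.* x ℤ.+ + 0 ≡
  c ℤ.* y ℤ.+ (c ℤ.* z ℤ.+ (- c ℤ.* w ℤ.+
    ((c ℤ.* (+ 1 ℤ.* + 1)) ℤ.* x ℤ.+ ((c ℤ.* (+ 1 ℤ.* - + 1)) ℤ.* y ℤ.+
    ((c ℤ.* (- + 1 ℤ.* + 1)) ℤ.* z ℤ.+ ((c ℤ.* (- + 1 ℤ.* - + 1)) ℤ.* w ℤ.+ + 0))))))
join-identity = solve-∀

module FiniteLattice {n : ℕ} (L : FinLattice n) where
  open FinLattice L
  open LatticeNotions L

  _≼?_ : Decidable _≼_
  x ≼? y with (x ∨ y) Fin.≟ y
  ... | yes x∨y≡y = yes (subst (x ≼_) x∨y≡y (∨-ubˡ x y))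
  ... | no  x∨y≢y = no λ x≼y → x∨y≢y (≼-antisym (∨-least x≼y (≼-refl y)) (∨-ubʳ x y))

  _≺?_ : Decidable _≺_
  x ≺? y = (x ≼? y) ×-dec ¬? (x Fin.≟ y)

  ≼-isPartialOrder : IsPartialOrder _≡_ _≼_
  ≼-isPartialOrder = record
    { isPreorder = record
      { isEquivalence = isEquivalence
      ; reflexive = λ { refl → ≼-refl _ }
      ; trans = ≼-trans
      }
    ; antisym = ≼-antisym
    }

  ≺-wellFounded : WellFounded _≺_
  ≺-wellFounded = po-wellFounded ≼-isPartialOrder

  ≻-wellFounded : WellFounded (flip _≺_)
  ≻-wellFounded = po-noetherian ≼-isPartialOrder

  atom-≢⊥ : ∀ {a} → IsAtom a → a ≢ ⊥
  atom-≢⊥ ((_ , ⊥≢a) , _) a≡⊥ = ⊥≢a (sym a≡⊥)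

  ≢⊥-mono : ∀ {x y} → x ≼ y → x ≢ ⊥ → y ≢ ⊥
  ≢⊥-mono {x} x≼y x≢⊥ refl = x≢⊥ (≼-antisym x≼y (⊥-min x))

  minimal-below : ∀ {ℓ} {Q : Pred (Fin n) ℓ} → U.Decidable Q → ∀ {z} → Q z →
                  Σ (Fin n) λ g → Q g × g ≼ z × (∀ y → Q y → ¬ y ≺ g)
  minimal-below {Q = Q} Q? {z} Qz = go (≺-wellFounded z) Qz
    where
    go : ∀ {z} → Acc _≺_ z → Q z → Σ (Fin n) λ g → Q g × g ≼ z × (∀ y → Q y → ¬ y ≺ g)
    go {z} (acc rec) Qz with Fin.any? (λ y → Q? y ×-dec (y ≺? z))
    ... | yes (y , Qy , y≺z) = let g , Qg , g≼y , minimal = go (rec y≺z) Qy in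
                               g , Qg , ≼-trans g≼y (proj₁ y≺z) , minimal
    ... | no  none           = z , Qz , ≼-refl z , λ y Qy y≺z → none (y , Qy , y≺z)

  cover-below : ∀ {p h} → p ≺ h → Σ (Fin n) λ g → p ⋖ g × g ≼ h
  cover-below {p} p≺h =
    let g , p≺g , g≼h , minimal = minimal-below (p ≺?_) p≺h in g , (p≺g , λ z p≺z z≺g → minimal z p≺z z≺g) , g≼h

  saturatedChain : ∀ {p h} → p ≼ h → ∃ (SatChain p h)
  saturatedChain {p} {h} = go (≻-wellFounded p)
    where
    go : ∀ {p} → Acc (flip _≺_) p → p ≼ h → ∃ (SatChain p h)
    go {p} (acc rec) p≼h with p Fin.≟ h
    ... | yes refl = 0 , done p
    ... | no  p≢h  = let g , p⋖g , g≼h = cover-below (p≼h , p≢h)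
                         k , g→h = go (rec (proj₁ p⋖g)) g≼h
                     in suc k , step p⋖g g→h

  _++ᶜ_ : ∀ {x y z k l} → SatChain x y k → SatChain y z l → SatChain x z (k + l)
  done _     ++ᶜ d = d
  step x⋖y c ++ᶜ d = step x⋖y (c ++ᶜ d)

  satChain-≼ : ∀ {p h k} → SatChain p h k → p ≼ h
  satChain-≼ (done p)       = ≼-refl p
  satChain-≼ (step p⋖g g→h) = ≼-trans (proj₁ (proj₁ p⋖g)) (satChain-≼ g→h)

  isAtom? : U.Decidable IsAtom
  isAtom? a = (⊥ ≺? a) ×-dec map′ (λ h z ⊥≺z z≺a → h z (⊥≺z , z≺a))
                                 (λ h z (⊥≺z , z≺a) → h z ⊥≺z z≺a)
                                 (Fin.all? λ z → ¬? ((⊥ ≺? z) ×-dec (z ≺? a)))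

module _ {n : ℕ} (M : Matroid n) where
  open Matroid M
  open ChowRing M
  open FiniteLattice lattice

  rank-satChain : ∀ {p h k} → SatChain p h k → rk h ≡ rk p + k
  rank-satChain {p} {h} {k} p→h =
    let k₀ , ⊥→p = saturatedChain (⊥-min p)
    in trans (sym (ranked h _ (⊥→p ++ᶜ p→h))) (cong (_+ k) (ranked p k₀ ⊥→p))

  rank-gap : ∀ {p h k} → SatChain p h k → rk h ∸ rk p ≡ k
  rank-gap {p} {k = k} p→h = trans (cong (_∸ rk p) (rank-satChain p→h)) (ℕ.m+n∸m≡n (rk p) k)

  rk⊥ : rk ⊥ ≡ 0
  rk⊥ = sym (ranked ⊥ 0 (done ⊥))

  rk-mono : ∀ {p h} → p ≼ h → rk p ≤ rk h
  rk-mono {p} p≼h = let k , p→h = saturatedChain p≼h in subst (rk p ≤_) (sym (rank-satChain p→h)) (ℕ.m≤m+n (rk p) k)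

  rk-mono-< : ∀ {p h} → p ≺ h → rk p < rk h
  rk-mono-< {p} {h} (p≼h , p≢h) with saturatedChain p≼h
  ... | _ , done _             = contradiction refl p≢h
  ... | suc k , p→h@(step _ _) = subst (rk p <_) (sym (rank-satChain p→h)) (ℕ.m<m+n (rk p) (s≤s z≤n))

  cover-by-atom : ∀ {x y} → x ⋖ y → Σ (Fin n) λ a → IsAtom a × x ∨ a ≡ y
  cover-by-atom {x} {y} ((x≼y , x≢y) , nothing-between)
    with Fin.any? (λ a → isAtom? a ×-dec ((a ≼? y) ×-dec ¬? (a ≼? x)))
  ... | no  none = contradiction (≼-antisym x≼y (atomic y x atoms-below-x)) x≢y
    where
    atoms-below-x : ∀ a → IsAtom a → a ≼ y → a ≼ x
    atoms-below-x a atom a≼y with a ≼? x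
    ... | yes a≼x = a≼x
    ... | no  a⋠x = contradiction (a , atom , a≼y , a⋠x) none
  ... | yes (a , atom , a≼y , a⋠x) with (x ∨ a) Fin.≟ y
  ...   | yes x∨a≡y = a , atom , x∨a≡y
  ...   | no  x∨a≢y = contradiction (∨-least x≼y a≼y , x∨a≢y) (nothing-between (x ∨ a) x≺x∨a)
    where
    x≺x∨a : x ≺ (x ∨ a)
    x≺x∨a = ∨-ubˡ x a , λ x≡x∨a → a⋠x (subst (a ≼_) (sym x≡x∨a) (∨-ubʳ x a))

  ValidMon : Mon n → Set
  ValidMon e = lookup e ⊥ ≡ 0

  ValidMon-⊕ : ∀ {u v} → ValidMon u → ValidMon v → ValidMon (u ⊕ v)
  ValidMon-⊕ {u} {v} u⊥ v⊥ = trans (Vec.lookup-zipWith _+_ ⊥ u v) (cong₂ _+_ u⊥ v⊥)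

  ValidMon-⊕⁻ˡ : ∀ u v → ValidMon (u ⊕ v) → ValidMon u
  ValidMon-⊕⁻ˡ u v uv⊥ = ℕ.m+n≡0⇒m≡0 (lookup u ⊥) (trans (sym (Vec.lookup-zipWith _+_ ⊥ u v)) uv⊥)

  ValidMon-unitExp : ∀ {F} → F ≢ ⊥ → ValidMon (unitExp F)
  ValidMon-unitExp {F} F≢⊥ =
    trans (Vec.lookup∘updateAt′ ⊥ F (F≢⊥ ∘ sym) (replicate n 0)) (Vec.lookup-replicate ⊥ 0)

  ValidMon-powExp : ∀ {F} a → F ≢ ⊥ → ValidMon (powExp F a)
  ValidMon-powExp         zero    F≢⊥ = Vec.lookup-replicate ⊥ 0
  ValidMon-powExp {F = F} (suc a) F≢⊥ =
    ValidMon-⊕ {unitExp F} (ValidMon-unitExp F≢⊥) (ValidMon-powExp a F≢⊥)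

  term : ℤ → Mon n → Poly n
  term c e = (c , e) ∷ []

  infix 4 _≡ᴵ_

  -- A record rather than a Σ-type, so that p and q can be inferred from p ≡ᴵ q; likewise _⊏_ below.
  record _≡ᴵ_ (p q : Poly n) : Set where
    constructor mk≡ᴵ
    field
      witness : IdealWitness
      valid   : ValidIdealWitness witness
      ≈P-sum  : p ≈P (q +P idealElem witness)

  idealElem-++ : ∀ W W′ → idealElem (W ++ W′) ≡ idealElem W ++ idealElem W′
  idealElem-++ []            W′ = refl
  idealElem-++ ((q , g) ∷ W) W′ =
    trans (cong ((q *P g) ++_) (idealElem-++ W W′)) (sym (List.++-assoc (q *P g) _ _))

  ≈P⇒≡ᴵ : ∀ {p q} → p ≈P q → p ≡ᴵ q
  ≈P⇒≡ᴵ {q = q} p≈q = mk≡ᴵ [] [] λ m → trans (p≈q m) (cong (λ r → coeff r m) (sym (List.++-identityʳ q)))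

  δ-sum⇒≡ᴵ : ∀ {p q} → (∀ m → δ-sum p m ≡ δ-sum q m) → p ≡ᴵ q
  δ-sum⇒≡ᴵ {p} {q} eq = ≈P⇒≡ᴵ (≈P-by-δ-sum {p = p} {q} eq)

  ≡ᴵ-refl : ∀ {p} → p ≡ᴵ p
  ≡ᴵ-refl {p} = ≈P⇒≡ᴵ {p} {p} λ _ → refl

  ≡⇒≡ᴵ : ∀ {p q} → p ≡ q → p ≡ᴵ q
  ≡⇒≡ᴵ refl = ≡ᴵ-refl

  ≡ᴵ-trans : ∀ {p q r} → p ≡ᴵ q → q ≡ᴵ r → p ≡ᴵ r
  ≡ᴵ-trans {p} {q} {r} (mk≡ᴵ W₁ valid₁ p≈q+I₁) (mk≡ᴵ W₂ valid₂ q≈r+I₂) =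
    mk≡ᴵ (W₂ ++ W₁) (All.++⁺ valid₂ valid₁) λ m → begin
      coeff p m                                   ≡⟨ trans (p≈q+I₁ m) (coeff-++ q I₁ m) ⟩
      coeff q m ℤ.+ coeff I₁ m                    ≡⟨ cong (ℤ._+ coeff I₁ m) (trans (q≈r+I₂ m) (coeff-++ r I₂ m)) ⟩
      coeff r m ℤ.+ coeff I₂ m ℤ.+ coeff I₁ m     ≡⟨ ℤ.+-assoc (coeff r m) _ _ ⟩
      coeff r m ℤ.+ (coeff I₂ m ℤ.+ coeff I₁ m)   ≡⟨ cong (λ s → coeff r m ℤ.+ s) (coeff-++ I₂ I₁ m) ⟨
      coeff r m ℤ.+ coeff (I₂ ++ I₁) m            ≡⟨ coeff-++ r (I₂ ++ I₁) m ⟨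
      coeff (r ++ (I₂ ++ I₁)) m                   ≡⟨ cong (λ s → coeff (r ++ s) m) (idealElem-++ W₂ W₁) ⟨
      coeff (r ++ idealElem (W₂ ++ W₁)) m         ∎
    where
    open ≡-Reasoning
    I₁ = idealElem W₁
    I₂ = idealElem W₂

  ≡ᴵ-++ : ∀ {p p′ q q′} → p ≡ᴵ p′ → q ≡ᴵ q′ → p ++ q ≡ᴵ p′ ++ q′
  ≡ᴵ-++ {p} {p′} {q} {q′} (mk≡ᴵ W₁ valid₁ p≈p′+I₁) (mk≡ᴵ W₂ valid₂ q≈q′+I₂) =
    mk≡ᴵ (W₁ ++ W₂) (All.++⁺ valid₁ valid₂) λ m → begin
      coeff (p ++ q) m
        ≡⟨ coeff-++ p q m ⟩
      coeff p m ℤ.+ coeff q m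
        ≡⟨ cong₂ ℤ._+_ (trans (p≈p′+I₁ m) (coeff-++ p′ I₁ m)) (trans (q≈q′+I₂ m) (coeff-++ q′ I₂ m)) ⟩
      (coeff p′ m ℤ.+ coeff I₁ m) ℤ.+ (coeff q′ m ℤ.+ coeff I₂ m)
        ≡⟨ ℤ+-interchange (coeff p′ m) _ _ _ ⟩
      (coeff p′ m ℤ.+ coeff q′ m) ℤ.+ (coeff I₁ m ℤ.+ coeff I₂ m)
        ≡⟨ cong₂ ℤ._+_ (coeff-++ p′ q′ m) (coeff-++ I₁ I₂ m) ⟨
      coeff (p′ ++ q′) m ℤ.+ coeff (I₁ ++ I₂) m
        ≡⟨ coeff-++ (p′ ++ q′) (I₁ ++ I₂) m ⟨
      coeff ((p′ ++ q′) ++ (I₁ ++ I₂)) m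
        ≡⟨ cong (λ s → coeff ((p′ ++ q′) ++ s) m) (idealElem-++ W₁ W₂) ⟨
      coeff ((p′ ++ q′) ++ idealElem (W₁ ++ W₂)) m
        ∎
    where
    open ≡-Reasoning
    I₁ = idealElem W₁
    I₂ = idealElem W₂

  generator-multiple≡ᴵ[] : ∀ {q g} → ValidPoly q → IsGenerator g → q *P g ≡ᴵ []
  generator-multiple≡ᴵ[] {q} {g} valid-q generator =
    mk≡ᴵ ((q , g) ∷ []) ((valid-q , generator) ∷ []) λ m → cong (λ r → coeff r m) (sym (List.++-identityʳ (q *P g)))

  term-negate-swap : ∀ {c e₁ e₂} → term (- c) e₁ ≡ᴵ term (- c) e₂ → term c e₂ ≡ᴵ term c e₁
  term-negate-swap {c} {e₁} {e₂} (mk≡ᴵ W valid −ce₁≈−ce₂+I) =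
    mk≡ᴵ W valid (≈P-by-δ-sum {p = term c e₂} {term c e₁ ++ idealElem W} λ m →
      negate-swap c (δ e₁ m) (δ e₂ m) (δ-sum (idealElem W) m)
                  (δ-sum-resp {p = term (- c) e₁} {term (- c) e₂ ++ idealElem W} −ce₁≈−ce₂+I m))

  Reducible : Poly n → Set
  Reducible p = Σ (List (ℤ × List (Fin n × ℕ))) λ L → All (λ t → ValidChain (proj₂ t)) L × p ≡ᴵ combination L

  Reducible-[] : Reducible []
  Reducible-[] = [] , [] , ≡ᴵ-refl

  Reducible-++ : ∀ {p q} → Reducible p → Reducible q → Reducible (p ++ q)
  Reducible-++ (L₁ , valid₁ , p≡L₁) (L₂ , valid₂ , q≡L₂) =
    L₁ ++ L₂ , All.++⁺ valid₁ valid₂ , ≡ᴵ-trans (≡ᴵ-++ p≡L₁ q≡L₂) (≡⇒≡ᴵ (sym (List.map-++ _ L₁ L₂)))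

  Reducible-resp : ∀ {p q} → p ≡ᴵ q → Reducible q → Reducible p
  Reducible-resp p≡q (L , valid , q≡L) = L , valid , ≡ᴵ-trans p≡q q≡L

  Reducible-chain : ∀ c {ch} → ValidChain ch → Reducible (term c (chainExp ch))
  Reducible-chain c {ch} valid = (c , ch) ∷ [] , valid ∷ [] , ≡ᴵ-refl

  -- Quantifying over the coefficient c makes _∼_ symmetric (use − c) without negating ideal witnesses.
  infix 4 _∼_

  _∼_ : Mon n → Mon n → Set
  e₁ ∼ e₂ = ∀ c {m} → ValidMon m → term c (m ⊕ e₁) ≡ᴵ term c (m ⊕ e₂)

  ∼-isEquivalence : IsEquivalence _∼_
  ∼-isEquivalence = record
    { refl  = λ _ _ → ≡ᴵ-refl
    ; sym   = λ e₁∼e₂ c valid → term-negate-swap (e₁∼e₂ (- c) valid)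
    ; trans = λ e₁∼e₂ e₂∼e₃ c valid → ≡ᴵ-trans (e₁∼e₂ c valid) (e₂∼e₃ c valid)
    }

  ∼-setoid : Setoid 0ℓ 0ℓ
  ∼-setoid = record { isEquivalence = ∼-isEquivalence }

  open IsEquivalence ∼-isEquivalence using () renaming (refl to ∼-refl; sym to ∼-sym)

  ∼-congˡ : ∀ {u e₁ e₂} → ValidMon u → e₁ ∼ e₂ → u ⊕ e₁ ∼ u ⊕ e₂
  ∼-congˡ {u} {e₁} {e₂} valid-u e₁∼e₂ c {m} valid-m =
    subst₂ (λ x y → term c x ≡ᴵ term c y) (⊕-assoc m u e₁) (⊕-assoc m u e₂)
           (e₁∼e₂ c (ValidMon-⊕ {m} valid-m valid-u))

  ∼-congʳ : ∀ {u e₁ e₂} → ValidMon u → e₁ ∼ e₂ → e₁ ⊕ u ∼ e₂ ⊕ u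
  ∼-congʳ {u} {e₁} {e₂} valid-u e₁∼e₂ = subst₂ _∼_ (⊕-comm u e₁) (⊕-comm u e₂) (∼-congˡ valid-u e₁∼e₂)

  Vanishes : Mon n → Set
  Vanishes e = ∀ c {m} → ValidMon m → term c (m ⊕ e) ≡ᴵ []

  Vanishes-∼ : ∀ {e₁ e₂} → e₁ ∼ e₂ → Vanishes e₂ → Vanishes e₁
  Vanishes-∼ e₁∼e₂ e₂-vanishes c valid = ≡ᴵ-trans (e₁∼e₂ c valid) (e₂-vanishes c valid)

  Vanishes-⊕ʳ : ∀ {u e} → ValidMon u → Vanishes e → Vanishes (e ⊕ u)
  Vanishes-⊕ʳ {u} {e} valid-u e-vanishes c {m} valid-m =
    subst (λ x → term c x ≡ᴵ []) (sym (x∙yz≈xz∙y m e u)) (e-vanishes c (ValidMon-⊕ {m} valid-m valid-u))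

  atom-vanishes : ∀ {a} → IsAtom a → Vanishes (unitExp a)
  atom-vanishes {a} atom c {m} valid-m =
    ≡ᴵ-trans (≡⇒≡ᴵ (cong (λ d → term d (m ⊕ unitExp a)) (sym (ℤ.*-identityʳ c))))
             (generator-multiple≡ᴵ[] {q = term c m} (valid-m ∷ []) (inj₂ (a , atom , refl)))

  cover-relation : ∀ {x y} → x ⋖ y → x ≢ ⊥ → unitExp y ⊕ unitExp x ∼ unitExp y ⊕ unitExp y
  cover-relation {x} x⋖y x≢⊥ c {m} valid-m with cover-by-atom x⋖y
  ... | a , atom , refl =
    ≡ᴵ-trans expand (≡ᴵ-++ {p = term c (m ⊕ (U y ⊕ U y))} ≡ᴵ-refl
                           (≡ᴵ-++ (a-multiple x≢⊥) (≡ᴵ-++ (a-multiple y≢⊥) generator-multiple)))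
    where
    y = x ∨ a
    U = unitExp
    y≢⊥ : y ≢ ⊥
    y≢⊥ = ≢⊥-mono (∨-ubˡ x a) x≢⊥
    generator = varDiff a (x ∨ a) *P varDiff x (x ∨ a)
    expand : term c (m ⊕ (U y ⊕ U x)) ≡ᴵ
             (c , m ⊕ (U y ⊕ U y)) ∷ (c , m ⊕ (U a ⊕ U x)) ∷ (- c , m ⊕ (U a ⊕ U y)) ∷ (term (- c) m *P generator)
    expand = δ-sum⇒≡ᴵ λ _ → cover-identity c _ _ _ _
    a-multiple : ∀ {z} → z ≢ ⊥ → ∀ {d} → term d (m ⊕ (U a ⊕ U z)) ≡ᴵ []
    a-multiple z≢⊥ {d} = Vanishes-⊕ʳ (ValidMon-unitExp z≢⊥) (atom-vanishes atom) d valid-m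
    generator-multiple : term (- c) m *P generator ≡ᴵ []
    generator-multiple =
      generator-multiple≡ᴵ[] {q = term (- c) m} (valid-m ∷ []) (inj₁ (a , x , atom-≢⊥ atom , x≢⊥ , refl))

  join-relation : ∀ {F G} → F ≢ ⊥ → G ≢ ⊥ → ∀ c {m} → ValidMon m → let U = unitExp ; J = G ∨ F in
    term c (m ⊕ (U F ⊕ U G)) ≡ᴵ (c , m ⊕ (U F ⊕ U J)) ∷ (c , m ⊕ (U J ⊕ U G)) ∷ (- c , m ⊕ (U J ⊕ U J)) ∷ []
  join-relation {F} {G} F≢⊥ G≢⊥ c {m} valid-m =
    ≡ᴵ-trans (δ-sum⇒≡ᴵ λ _ → join-identity c _ _ _ _)
             (≡ᴵ-++ {p = (c , m ⊕ (U F ⊕ U J)) ∷ (c , m ⊕ (U J ⊕ U G)) ∷ (- c , m ⊕ (U J ⊕ U J)) ∷ []} ≡ᴵ-refl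
                    (generator-multiple≡ᴵ[] {q = term c m} (valid-m ∷ []) (inj₁ (F , G , F≢⊥ , G≢⊥ , refl))))
    where
    U = unitExp
    J = G ∨ F

  collapse-along : ∀ {p h k} → SatChain p h k → p ≢ ⊥ → ∀ a → k ≤ a →
                   unitExp p ⊕ powExp h a ∼ powExp h (suc a)
  collapse-along (done _) _ a _ = ∼-refl
  collapse-along {p} {h} (step {y = g} p⋖g g→h) p≢⊥ (suc a) (s≤s k≤a) = begin
    U p ⊕ (U h ⊕ A)    ≈⟨ ∼-congˡ (ValidMon-unitExp p≢⊥) (∼-sym g→h-collapses) ⟩
    U p ⊕ (U g ⊕ A)    ≡⟨ x∙yz≈yx∙z (U p) (U g) A ⟩
    (U g ⊕ U p) ⊕ A    ≈⟨ ∼-congʳ (ValidMon-powExp a h≢⊥) (cover-relation p⋖g p≢⊥) ⟩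
    (U g ⊕ U g) ⊕ A    ≡⟨ ⊕-assoc (U g) (U g) A ⟩
    U g ⊕ (U g ⊕ A)    ≈⟨ ∼-congˡ (ValidMon-unitExp g≢⊥) g→h-collapses ⟩
    U g ⊕ (U h ⊕ A)    ≡⟨ x∙yz≈y∙xz (U g) (U h) A ⟩
    U h ⊕ (U g ⊕ A)    ≈⟨ ∼-congˡ (ValidMon-unitExp h≢⊥) g→h-collapses ⟩
    U h ⊕ (U h ⊕ A)    ∎
    where
    open SetoidReasoning ∼-setoid
    U = unitExp
    A = powExp h a
    g≢⊥ = ≢⊥-mono (proj₁ (proj₁ p⋖g)) p≢⊥
    h≢⊥ = ≢⊥-mono (satChain-≼ g→h) g≢⊥
    g→h-collapses : U g ⊕ A ∼ U h ⊕ A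
    g→h-collapses = collapse-along g→h g≢⊥ a k≤a

  collapse : ∀ {p h a} → p ≢ ⊥ → p ≼ h → rk h ∸ rk p ≤ a → unitExp p ⊕ powExp h a ∼ powExp h (suc a)
  collapse {p} {h} {a} p≢⊥ p≼h gap≤a =
    let k , p→h = saturatedChain p≼h in collapse-along p→h p≢⊥ a (subst (_≤ a) (rank-gap p→h) gap≤a)

  vanish-along : ∀ {h k} → SatChain ⊥ h k → h ≢ ⊥ → ∀ a → k ≤ a → Vanishes (powExp h a)
  vanish-along (done _)           ⊥≢⊥ _       _         = contradiction refl ⊥≢⊥
  vanish-along (step ⊥⋖g g→h) h≢⊥ (suc a) (s≤s k≤a) =
    Vanishes-∼ (∼-sym (collapse-along g→h (atom-≢⊥ ⊥⋖g) a k≤a))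
               (Vanishes-⊕ʳ (ValidMon-powExp a h≢⊥) (atom-vanishes ⊥⋖g))

  vanish : ∀ {h a} → ⊥ ≺ h → rk h ≤ a → Vanishes (powExp h a)
  vanish {h} {a} (⊥≼h , ⊥≢h) rk≤a =
    let k , ⊥→h = saturatedChain ⊥≼h
    in vanish-along ⊥→h (⊥≢h ∘ sym) a (subst (_≤ a) (sym (ranked h k ⊥→h)) rk≤a)

  _∈supp_ : Fin n → Mon n → Set
  F ∈supp e = 0 < lookup e F

  ∈supp-valid⇒⊥≺ : ∀ e → ValidMon e → ∀ {F} → F ∈supp e → ⊥ ≺ F
  ∈supp-valid⇒⊥≺ e valid {F} F∈ = ⊥-min F , λ { refl → ℕ.<-irrefl (sym valid) F∈ }

  Comparable : Mon n → Set
  Comparable e = ∀ {F G} → F ∈supp e → G ∈supp e → F ≼ G ⊎ G ≼ F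

  Incomparable : Fin n → Fin n → Set
  Incomparable F G = ¬ F ≼ G × ¬ G ≼ F

  incomparable-or-comparable : ∀ e → (∃₂ λ F G → F ∈supp e × G ∈supp e × Incomparable F G) ⊎ Comparable e
  incomparable-or-comparable e
    with Fin.any? (λ F → Fin.any? λ G → (0 <? lookup e F) ×-dec (0 <? lookup e G) ×-dec ¬? (F ≼? G) ×-dec ¬? (G ≼? F))
  ... | yes (F , G , F∈ , G∈ , F⋠G , G⋠F) = inj₁ (F , G , F∈ , G∈ , F⋠G , G⋠F)
  ... | no  none                          = inj₂ comparable
    where
    comparable : Comparable e
    comparable {F} {G} F∈ G∈ with F ≼? G | G ≼? F
    ... | yes F≼G | _       = inj₁ F≼G
    ... | no  _   | yes G≼F = inj₂ G≼F
    ... | no  F⋠G | no  G⋠F = contradiction (F , G , F∈ , G∈ , F⋠G , G⋠F) none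

  comparable-minimal⇒least : ∀ e {F} → Comparable e → F ∈supp e → (∀ G → G ∈supp e → ¬ G ≺ F) →
                             ∀ {G} → G ∈supp e → F ≼ G
  comparable-minimal⇒least e {F} comparable F∈ minimal {G} G∈ with comparable F∈ G∈ | G Fin.≟ F
  ... | inj₁ F≼G | _        = F≼G
  ... | inj₂ _   | yes refl = ≼-refl F
  ... | inj₂ G≼F | no  G≢F  = contradiction (G≼F , G≢F) (minimal G G∈)

  clear : Fin n → Mon n → Mon n
  clear F e = updateAt e F (const 0)

  ∈supp-clear : ∀ F e {G} → G ∈supp clear F e → F ≢ G × G ∈supp e
  ∈supp-clear F e {G} G∈ with F Fin.≟ G
  ... | yes refl = contradiction (subst (0 <_) (Vec.lookup∘updateAt F e) G∈) (λ ())
  ... | no  F≢G  = F≢G , subst (0 <_) (Vec.lookup∘updateAt′ G F (F≢G ∘ sym) e) G∈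

  restore-clear : ∀ F e → updateAt (clear F e) F (_+ lookup e F) ≡ e
  restore-clear F e = trans (Vec.updateAt-updateAt-local F e refl) (Vec.updateAt-id F e)

  Increasing : Fin n → List (Fin n × ℕ) → Set
  Increasing prev []            = Unit.⊤
  Increasing prev ((F , a) ∷ r) = prev ≺ F × 0 < a × Increasing F r

  chain-of-support : ∀ {prev} e → Comparable e → (∀ {F} → F ∈supp e → prev ≺ F) →
                     Σ (List (Fin n × ℕ)) λ ch → chainExp ch ≡ e × Increasing prev ch
  chain-of-support {prev} = go (≻-wellFounded prev)
    where
    go : ∀ {prev} → Acc (flip _≺_) prev → ∀ e → Comparable e → (∀ {F} → F ∈supp e → prev ≺ F) →
         Σ (List (Fin n × ℕ)) λ ch → chainExp ch ≡ e × Increasing prev ch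
    go (acc rec) e comparable above with Fin.any? (λ F → 0 <? lookup e F)
    ... | no none = [] , 𝟎-by-lookup e (λ i → ℕ.n≤0⇒n≡0 (ℕ.≮⇒≥ (λ i∈ → none (i , i∈)))) , Unit.tt
    ... | yes (F₀ , F₀∈) =
      let F , F∈ , _ , minimal = minimal-below (λ F → 0 <? lookup e F) F₀∈
          least = comparable-minimal⇒least e comparable F∈ minimal
          ch , ch≡ , increasing = go (rec (above F∈)) (clear F e)
                                     (λ G∈ H∈ → comparable (proj₂ (∈supp-clear F e G∈)) (proj₂ (∈supp-clear F e H∈)))
                                     (λ G∈ → let F≢G , G∈e = ∈supp-clear F e G∈ in least G∈e , F≢G)
      in (F , lookup e F) ∷ ch , trans (cong (λ c → updateAt c F (_+ lookup e F)) ch≡) (restore-clear F e) ,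
         above F∈ , F∈ , increasing

  chainExp-∷ : ∀ F a r → chainExp ((F , a) ∷ r) ≡ powExp F a ⊕ chainExp r
  chainExp-∷ F a r = sym (powExp-⊕ F a (chainExp r))

  data Violation (e : Mon n) : Set where
    rank-exceeded : ∀ {h a m} → ⊥ ≺ h → rk h ≤ a → ValidMon m → e ≡ m ⊕ powExp h a → Violation e
    gap-exceeded  : ∀ {p h a m} → p ≢ ⊥ → p ≺ h → rk h ∸ rk p ≤ a → ValidMon m →
                    e ≡ m ⊕ (unitExp p ⊕ powExp h a) → Violation e

  -- x is the already checked part of the monomial; unless prev = ⊥ it contains a factor h_prev,
  -- which gap-exceeded needs.
  validate : ∀ {prev} ch x → Increasing prev ch → (prev ≢ ⊥ → ∃ λ y → x ≡ unitExp prev ⊕ y) →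
             ValidMon (x ⊕ chainExp ch) → ValidChainFrom prev ch ⊎ Violation (x ⊕ chainExp ch)
  validate [] x _ _ _ = inj₁ Unit.tt
  validate {prev} ((F , a) ∷ r) x (prev≺F , 0<a , increasing) prev∣x valid with a <? rk F ∸ rk prev
  ... | yes a<gap =
    Sum.map (λ valid-r → prev≺F , 0<a , a<gap , valid-r) (subst Violation (sym shift))
            (validate r (x ⊕ powExp F a) increasing (λ _ → F∣x⊕Fᵃ 0<a) (subst ValidMon shift valid))
    where
    shift : x ⊕ chainExp ((F , a) ∷ r) ≡ (x ⊕ powExp F a) ⊕ chainExp r
    shift = trans (cong (x ⊕_) (chainExp-∷ F a r)) (sym (⊕-assoc x _ _))
    F∣x⊕Fᵃ : 0 < a → ∃ λ y → x ⊕ powExp F a ≡ unitExp F ⊕ y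
    F∣x⊕Fᵃ (s≤s {n = a′} _) = x ⊕ powExp F a′ , x∙yz≈y∙xz x (unitExp F) (powExp F a′)
  ... | no a≮gap with prev Fin.≟ ⊥
  ...   | yes refl =
    inj₂ (rank-exceeded prev≺F (ℕ.≮⇒≥ (subst (λ r → ¬ a < rk F ∸ r) rk⊥ a≮gap))
                        (ValidMon-⊕⁻ˡ (x ⊕ chainExp r) (powExp F a) (subst ValidMon split valid)) split)
    where
    split : x ⊕ chainExp ((F , a) ∷ r) ≡ (x ⊕ chainExp r) ⊕ powExp F a
    split = trans (cong (x ⊕_) (chainExp-∷ F a r)) (x∙yz≈xz∙y x _ _)
  ...   | no prev≢⊥ with prev∣x prev≢⊥
  ...     | y , refl =
    inj₂ (gap-exceeded prev≢⊥ prev≺F (ℕ.≮⇒≥ a≮gap)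
                       (ValidMon-⊕⁻ˡ (y ⊕ chainExp r) (unitExp prev ⊕ powExp F a) (subst ValidMon split valid)) split)
    where
    split : (unitExp prev ⊕ y) ⊕ chainExp ((F , a) ∷ r) ≡ (y ⊕ chainExp r) ⊕ (unitExp prev ⊕ powExp F a)
    split = trans (cong ((unitExp prev ⊕ y) ⊕_) (chainExp-∷ F a r)) (xy⊕zw≡yw⊕xz (unitExp prev) y _ _)

  -- Every move replaces a flat by a strictly larger one, and larger flats have smaller corank.
  corank : Fin n → ℕ
  corank F = rk ⊤ ∸ rk F

  μ : Mon n → ℕ
  μ = weight corank

  infix 4 _⊏_

  record _⊏_ (x y : Mon n) : Set where
    constructor mk⊏
    field μ-< : μ x < μ y

  ⊏-wellFounded : WellFounded _⊏_
  ⊏-wellFounded = Subrelation.wellFounded _⊏_.μ-< (On.wellFounded μ <-wellFounded)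

  unitExp-⊏ : ∀ {F G} → F ≺ G → unitExp G ⊏ unitExp F
  unitExp-⊏ {F} {G} F≺G = mk⊏ (subst₂ _<_ (sym (weight-unitExp corank G)) (sym (weight-unitExp corank F))
                                         (ℕ.∸-monoʳ-< (rk-mono-< F≺G) (rk-mono (⊤-max G))))

  ⊏-⊕ˡ : ∀ {m x y} → x ⊏ y → m ⊕ x ⊏ m ⊕ y
  ⊏-⊕ˡ {m} {x} {y} (mk⊏ x<y) =
    mk⊏ (subst₂ _<_ (sym (weight-⊕ corank m x)) (sym (weight-⊕ corank m y)) (ℕ.+-monoʳ-< (μ m) x<y))

  ⊏-⊕ʳ : ∀ {m x y} → x ⊏ y → x ⊕ m ⊏ y ⊕ m
  ⊏-⊕ʳ {m} {x} {y} x⊏y = subst₂ _⊏_ (⊕-comm m x) (⊕-comm m y) (⊏-⊕ˡ x⊏y)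

  ⊏-trans : ∀ {x y z} → x ⊏ y → y ⊏ z → x ⊏ z
  ⊏-trans (mk⊏ x<y) (mk⊏ y<z) = mk⊏ (ℕ.<-trans x<y y<z)

  ReducibleBelow : Mon n → Set
  ReducibleBelow e = ∀ {e′} → e′ ⊏ e → ValidMon e′ → ∀ c → Reducible (term c e′)

  reduce-violation : ∀ {e} → ReducibleBelow e → Violation e → ∀ c → Reducible (term c e)
  reduce-violation _ (rank-exceeded ⊥≺h rk≤a valid-m refl) c =
    Reducible-resp (vanish ⊥≺h rk≤a c valid-m) Reducible-[]
  reduce-violation below (gap-exceeded {p} {h} {a} {m} p≢⊥ p≺h gap≤a valid-m refl) c =
    Reducible-resp (collapse p≢⊥ (proj₁ p≺h) gap≤a c valid-m)
                   (below (⊏-⊕ˡ (⊏-⊕ʳ (unitExp-⊏ p≺h)))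
                          (ValidMon-⊕ {m} valid-m (ValidMon-powExp (suc a) (≢⊥-mono (proj₁ p≺h) p≢⊥))) c)

  reduce-join : ∀ {m F G} → let U = unitExp in ReducibleBelow (m ⊕ (U F ⊕ U G)) → ValidMon m → Incomparable F G →
                ∀ c → Reducible (term c (m ⊕ (U F ⊕ U G)))
  reduce-join {m} {F} {G} below valid-m (F⋠G , G⋠F) c =
    Reducible-resp (join-relation F≢⊥ G≢⊥ c valid-m)
      (Reducible-++ (below (⊏-⊕ˡ (⊏-⊕ˡ (unitExp-⊏ G≺J))) (valid-m⊕ (valid F≢⊥) (valid J≢⊥)) c)
      (Reducible-++ (below (⊏-⊕ˡ (⊏-⊕ʳ (unitExp-⊏ F≺J))) (valid-m⊕ (valid J≢⊥) (valid G≢⊥)) c)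
      (Reducible-++ (below (⊏-⊕ˡ (⊏-trans (⊏-⊕ˡ (unitExp-⊏ G≺J)) (⊏-⊕ʳ (unitExp-⊏ F≺J))))
                           (valid-m⊕ (valid J≢⊥) (valid J≢⊥)) (- c))
       Reducible-[])))
    where
    U = unitExp
    J = G ∨ F
    valid = ValidMon-unitExp
    valid-m⊕ : ∀ {X Y} → ValidMon (U X) → ValidMon (U Y) → ValidMon (m ⊕ (U X ⊕ U Y))
    valid-m⊕ {X} vX vY = ValidMon-⊕ {m} valid-m (ValidMon-⊕ {U X} vX vY)
    F≢⊥ : F ≢ ⊥
    F≢⊥ refl = F⋠G (⊥-min G)
    G≢⊥ : G ≢ ⊥
    G≢⊥ refl = G⋠F (⊥-min F)
    J≢⊥ = ≢⊥-mono (∨-ubʳ G F) F≢⊥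
    F≺J : F ≺ J
    F≺J = ∨-ubʳ G F , λ F≡J → G⋠F (subst (G ≼_) (sym F≡J) (∨-ubˡ G F))
    G≺J : G ≺ J
    G≺J = ∨-ubˡ G F , λ G≡J → F⋠G (subst (F ≼_) (sym G≡J) (∨-ubʳ G F))

  reduce-incomparable : ∀ {e F G} → ReducibleBelow e → ValidMon e → F ∈supp e → G ∈supp e → Incomparable F G →
                        ∀ c → Reducible (term c e)
  reduce-incomparable {e} {F} {G} below valid F∈ G∈ (F⋠G , G⋠F) c =
    subst (λ x → ReducibleBelow x → Reducible (term c x)) factored
          (λ below′ → reduce-join below′ valid-m (F⋠G , G⋠F) c) below
    where
    m = decr G (decr F e)
    F≢G : F ≢ G
    F≢G refl = F⋠G (≼-refl F)
    factored : m ⊕ (unitExp F ⊕ unitExp G) ≡ e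
    factored = decr-decr-⊕-unitExps e F≢G F∈ G∈
    valid-m : ValidMon m
    valid-m = ValidMon-⊕⁻ˡ m (unitExp F ⊕ unitExp G) (subst ValidMon (sym factored) valid)

  reduce-comparable : ∀ {e} → ReducibleBelow e → ValidMon e → Comparable e → ∀ c → Reducible (term c e)
  reduce-comparable {e} below valid comparable c with chain-of-support e comparable (∈supp-valid⇒⊥≺ e valid)
  ... | ch , refl , increasing
      with validate ch 𝟎 increasing (λ ⊥≢⊥ → contradiction refl ⊥≢⊥) (subst ValidMon (sym (⊕-identityˡ _)) valid)
  ...   | inj₁ valid-chain = Reducible-chain c valid-chain
  ...   | inj₂ violation   = reduce-violation below (subst Violation (⊕-identityˡ _) violation) c

  reduce-term : ∀ {e} → ValidMon e → ∀ c → Reducible (term c e)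
  reduce-term {e} = go (⊏-wellFounded e)
    where
    go : ∀ {e} → Acc _⊏_ e → ValidMon e → ∀ c → Reducible (term c e)
    go {e} (acc rec) valid with incomparable-or-comparable e
    ... | inj₁ (F , G , F∈ , G∈ , incomparable) = reduce-incomparable (go ∘ rec) valid F∈ G∈ incomparable
    ... | inj₂ comparable                       = reduce-comparable (go ∘ rec) valid comparable

  reduce : ∀ p → ValidPoly p → Reducible p
  reduce []            []                = Reducible-[]
  reduce ((c , e) ∷ p) (valid ∷ valid-p) = Reducible-++ (reduce-term valid c) (reduce p valid-p)

proposition2p8 : (n : ℕ) → (M : Matroid n) → let open ChowRing M in
    (p : Poly n) → ValidPoly p →
    Σ (List (ℤ × List (Fin n × ℕ))) λ L → All (λ t → ValidChain (proj₂ t)) L ×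
      Σ IdealWitness λ W → ValidIdealWitness W ×
        (p ≈P (combination L +P idealElem W))
proposition2p8 n M p valid with reduce M p valid
... | L , valid-L , mk≡ᴵ W valid-W p≈L+W = L , valid-L , W , valid-W , p≈L+W
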